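{- There is no forbidden path in $G_0$. That is, there is no path $P=x_1-x_2-\cdots-x_k$ of odd length (i.e. $k-1$ odd) in $G_0$ such that, for some $i$, $x_1,x_k\in L_i$, $x_2,x_{k-1}\in L_{i+1}$, all vertices of $P$ lie in $L_{\ge i}$, and either $P$ is an induced path or $P+x_1x_k$ is a hole.
   Context: A hole is an induced cycle of length at least $4$; an even hole is a hole of even length. Let $G$ be a graph with no induced claw ($K_{1,3}$) and no even hole. Fix two adjacent vertices $u_0,u_1$ of $G$, let $B_0=N_G(u_0)\setminus\{u_1\}$, and let $G_0$ be the connected component of $G-B_0$ containing $u_0$. For $j\ge 0$, $L_j=\{u\in V(G_0): d_{G_0}(u,u_0)=j\}$ and $L_{\ge i}=\bigcup_{j\ge i}L_j$. A path consists of distinct vertices, consecutive ones adjacent; $P+x_1x_k$ denotes the graph obtained by adding the edge $x_1x_k$. -}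

module Defs where

open import Data.Nat using (ℕ; zero; suc; _+_; _*_; _≤_; _<_)
open import Data.Fin using (Fin; toℕ; fromℕ)
open import Data.Product using (Σ; ∃; ∃-syntax; _×_; _,_)
open import Data.Sum using (_⊎_)
open import Data.Empty using (⊥)
open import Relation.Nullary using (¬_)
open import Relation.Binary.PropositionalEquality using (_≡_; _≢_)
open import Relation.Binary using (Decidable)
open import Function.Definitions using (Injective)

record Graph (n : ℕ) : Set₁ where
  field
    Adj    : Fin n → Fin n → Set
    sym    : ∀ {u v} → Adj u v → Adj v u
    irrefl : ∀ {u} → ¬ Adj u u
    adj?   : Decidable Adj
open Graph public

module _ {n : ℕ} (G : Graph n) where

  Next : {k : ℕ} → Fin k → Fin k → Set
  Next i j = toℕ j ≡ suc (toℕ i)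

  Consec : {k : ℕ} → Fin k → Fin k → Set
  Consec i j = Next i j ⊎ Next j i

  CycConsec : {k : ℕ} → Fin k → Fin k → Set
  CycConsec {k} i j =
    Consec i j ⊎ ((toℕ i ≡ 0 × suc (toℕ j) ≡ k) ⊎ (toℕ j ≡ 0 × suc (toℕ i) ≡ k))

  IsPath : {k : ℕ} → (Fin k → Fin n) → Set
  IsPath x = Injective _≡_ _≡_ x × (∀ i j → Next i j → Adj G (x i) (x j))

  IsInducedPath : {k : ℕ} → (Fin k → Fin n) → Set
  IsInducedPath x = IsPath x × (∀ i j → Adj G (x i) (x j) → Consec i j)

  IsHole : {k : ℕ} → (Fin k → Fin n) → Set
  IsHole {k} c = 4 ≤ k × Injective _≡_ _≡_ c
    × (∀ i j → Adj G (c i) (c j) → CycConsec i j)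
    × (∀ i j → CycConsec i j → Adj G (c i) (c j))

  IsEven : ℕ → Set
  IsEven k = ∃[ m ] k ≡ m + m

  IsOdd : ℕ → Set
  IsOdd k = ∃[ m ] k ≡ suc (m + m)

  EvenHoleFree : Set
  EvenHoleFree = ∀ (k : ℕ) (c : Fin k → Fin n) → IsHole c → ¬ IsEven k

  ClawFree : Set
  ClawFree = ∀ (a b c d : Fin n) →
    Adj G a b → Adj G a c → Adj G a d →
    b ≢ c → b ≢ d → c ≢ d →
    ¬ Adj G b c → ¬ Adj G b d → ¬ Adj G c d → ⊥

  WalkIn : (S : Fin n → Set) → ℕ → Fin n → Fin n → Set
  WalkIn S ℓ u v = Σ (Fin (suc ℓ) → Fin n) λ w →
    w Data.Fin.zero ≡ u × w (fromℕ ℓ) ≡ v × (∀ i → S (w i))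
    × (∀ i j → Next i j → Adj G (w i) (w j))

  module Layers (u0 u1 : Fin n) where
    B0 : Fin n → Set
    B0 v = Adj G u0 v × v ≢ u1

    -- vertex set of G0: component of G - B0 containing u0
    InG0 : Fin n → Set
    InG0 v = ∃[ ℓ ] WalkIn (λ w → ¬ B0 w) ℓ u0 v

    L : ℕ → Fin n → Set
    L j v = InG0 v × WalkIn InG0 j u0 v × (∀ m → m < j → ¬ WalkIn InG0 m u0 v)

    L≥ : ℕ → Fin n → Set
    L≥ i v = ∃[ j ] (i ≤ j × L j v)

    -- a forbidden path of length ℓ, vertices x_1..x_k indexed by Fin (suc ℓ)
    ForbiddenPath : (ℓ : ℕ) → (Fin (suc ℓ) → Fin n) → Set
    ForbiddenPath ℓ x = IsOdd ℓ × IsPath x × (∀ j → InG0 (x j)) ×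
      (∃[ i ] (L i (x Data.Fin.zero) × L i (x (fromℕ ℓ))
        × (∀ j → toℕ j ≡ 1 → L (suc i) (x j))
        × (∀ j → suc (toℕ j) ≡ ℓ → L (suc i) (x j))
        × (∀ j → L≥ i (x j))))
      × (IsInducedPath x ⊎ IsHole x)

{-# OPTIONS --safe #-}
-- Induction on the layer i of the two endpoints of a forbidden path x₁ - ⋯ - xₖ. Since
-- L₀ = {u₀} and L₁ ⊆ {u₁}, for i ≤ 1 the endpoints would coincide, which is impossible for a
-- path of odd length; and a forbidden path closing to a hole is itself an even hole.
-- For an induced forbidden path with i ≥ 2, pick neighbours p of x₁ and q of xₖ in L_{i-1}.
-- By claw-freeness at p (the fourth vertex being a neighbour of p in L_{i-2}), the neighbours
-- of p in L_i are pairwise adjacent; as x₂ ∈ L_{i+1} and the path is induced, x₁ is the only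
-- neighbour of p on the path, and likewise xₖ for q. If p ~ q, then p - x₁ - ⋯ - xₖ - q - p
-- is an even hole; otherwise p - x₁ - ⋯ - xₖ - q is a forbidden path at layer i - 1.
module Submission where

open import Defs
open import Data.Nat using (ℕ; zero; suc; _≤_; _<_; z≤n; s≤s; s≤s⁻¹; _≟_)
open import Data.Nat.Properties
  using (≤-refl; ≤-trans; ≤-antisym; <⇒≤; <⇒≢; n≤1+n; n≮n; ≮⇒≥; 1+n≢n; +-suc; suc-injective;
         m≤n⇒m<n∨m≡n; <-cmp)
open import Data.Fin using (Fin; toℕ; fromℕ)
import Data.Fin as Fin
open import Data.Fin.Properties using (toℕ-injective; toℕ-fromℕ; toℕ≤pred[n])
import Data.Fin.Properties as Fin
open import Data.Product using (∃-syntax; _×_; _,_; proj₁; proj₂)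
open import Data.Sum using (_⊎_; inj₁; inj₂)
import Data.Sum as Sum
open import Data.Empty using (⊥-elim)
open import Function using (_∘_; id)
open import Relation.Nullary using (¬_; yes; no; contradiction)
open import Relation.Binary using (tri<; tri≈; tri>)
open import Relation.Binary.PropositionalEquality using (_≡_; _≢_; refl; trans; cong; subst)
import Relation.Binary.PropositionalEquality as ≡

-- Walks and paths are handled as ℕ-indexed sequences read up to an explicit bound;
-- clamp converts the Fin-indexed ones of WalkIn and IsInducedPath (it saturates at k).
clamp : (k : ℕ) → ℕ → Fin (suc k)
clamp k       zero    = Fin.zero
clamp zero    (suc m) = Fin.zero
clamp (suc k) (suc m) = Fin.suc (clamp k m)

toℕ-clamp : ∀ k {m} → m ≤ k → toℕ (clamp k m) ≡ m
toℕ-clamp k       z≤n       = refl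
toℕ-clamp (suc k) (s≤s m≤k) = cong suc (toℕ-clamp k m≤k)

clamp-top : ∀ k → clamp k k ≡ fromℕ k
clamp-top zero    = refl
clamp-top (suc k) = cong Fin.suc (clamp-top k)

clamp-injective : ∀ k {a b} → a ≤ k → b ≤ k → clamp k a ≡ clamp k b → a ≡ b
clamp-injective k a≤k b≤k e = trans (≡.sym (toℕ-clamp k a≤k)) (trans (cong toℕ e) (toℕ-clamp k b≤k))

toℕ-clamp-suc : ∀ k {a} → a < k → toℕ (clamp k (suc a)) ≡ suc (toℕ (clamp k a))
toℕ-clamp-suc k a<k rewrite toℕ-clamp k a<k | toℕ-clamp k (<⇒≤ a<k) = refl

toℕ-clamp-suc⁻¹ : ∀ k {a b} → a ≤ k → b ≤ k → toℕ (clamp k b) ≡ suc (toℕ (clamp k a)) → b ≡ suc a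
toℕ-clamp-suc⁻¹ k a≤k b≤k rewrite toℕ-clamp k a≤k | toℕ-clamp k b≤k = id

data ≤-suc-View (ℓ : ℕ) : ℕ → Set where
  ≤-this : ∀ {a} → a ≤ ℓ → ≤-suc-View ℓ a
  ≡-suc  : ≤-suc-View ℓ (suc ℓ)

≤-suc-view : ∀ {ℓ a} → a ≤ suc ℓ → ≤-suc-View ℓ a
≤-suc-view a≤1+ℓ with m≤n⇒m<n∨m≡n a≤1+ℓ
... | inj₁ a<1+ℓ = ≤-this (s≤s⁻¹ a<1+ℓ)
... | inj₂ refl  = ≡-suc

module _ {A : Set} where

  cons : A → (ℕ → A) → ℕ → A
  cons x f zero    = x
  cons x f (suc a) = f a

  snoc : ℕ → (ℕ → A) → A → ℕ → A
  snoc zero    f x zero    = f zero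
  snoc zero    f x (suc a) = x
  snoc (suc ℓ) f x zero    = f zero
  snoc (suc ℓ) f x (suc a) = snoc ℓ (f ∘ suc) x a

  snoc-≤ : ∀ {ℓ a} (f : ℕ → A) (x : A) → a ≤ ℓ → snoc ℓ f x a ≡ f a
  snoc-≤ {zero}  f x z≤n       = refl
  snoc-≤ {suc ℓ} f x z≤n       = refl
  snoc-≤ {suc ℓ} f x (s≤s a≤ℓ) = snoc-≤ (f ∘ suc) x a≤ℓ

  snoc-last : ∀ ℓ (f : ℕ → A) (x : A) → snoc ℓ f x (suc ℓ) ≡ x
  snoc-last zero    f x = refl
  snoc-last (suc ℓ) f x = snoc-last ℓ (f ∘ suc) x

  snoc-all : ∀ {ℓ} {f : ℕ → A} {x} (P : A → Set) →
             (∀ {a} → a ≤ ℓ → P (f a)) → P x → ∀ {a} → a ≤ suc ℓ → P (snoc ℓ f x a)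
  snoc-all {ℓ} {f} {x} P Pf Px a≤1+ℓ with ≤-suc-view a≤1+ℓ
  ... | ≤-this a≤ℓ rewrite snoc-≤ f x a≤ℓ = Pf a≤ℓ
  ... | ≡-suc      rewrite snoc-last ℓ f x = Px

  snoc-chain : ∀ {ℓ} {f : ℕ → A} {x} (R : A → A → Set) →
               (∀ {a} → a < ℓ → R (f a) (f (suc a))) → R (f ℓ) x →
               ∀ {a} → a < suc ℓ → R (snoc ℓ f x a) (snoc ℓ f x (suc a))
  snoc-chain {ℓ} {f} {x} R Rf Rx a<1+ℓ with m≤n⇒m<n∨m≡n (s≤s⁻¹ a<1+ℓ)
  ... | inj₁ a<ℓ rewrite snoc-≤ f x (<⇒≤ a<ℓ) | snoc-≤ f x a<ℓ = Rf a<ℓ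
  ... | inj₂ refl rewrite snoc-≤ f x (≤-refl {ℓ}) | snoc-last ℓ f x = Rx

module _ {n : ℕ} (G : Graph n) where

  odd⇒positive : ∀ {ℓ} → IsOdd G ℓ → 0 < ℓ
  odd⇒positive (m , refl) = s≤s z≤n

  odd⇒suc-even : ∀ {ℓ} → IsOdd G ℓ → IsEven G (suc ℓ)
  odd⇒suc-even (m , refl) = suc m , cong suc (≡.sym (+-suc m m))

  odd-suc-suc : ∀ {ℓ} → IsOdd G ℓ → IsOdd G (suc (suc ℓ))
  odd-suc-suc (m , refl) = suc m , cong (suc ∘ suc) (≡.sym (+-suc m m))

  record Walkℕ (S : Fin n → Set) (ℓ : ℕ) (u v : Fin n) : Set where
    field
      vertex : ℕ → Fin n
      start  : vertex 0 ≡ u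
      end    : vertex ℓ ≡ v
      inside : ∀ {a} → a ≤ ℓ → S (vertex a)
      step   : ∀ {a} → a < ℓ → Adj G (vertex a) (vertex (suc a))

  module _ {S : Fin n → Set} where

    fromWalkIn : ∀ {ℓ u v} → WalkIn G S ℓ u v → Walkℕ S ℓ u v
    fromWalkIn {ℓ} (w , w₀ , wℓ , inside , step) = record
      { vertex = w ∘ clamp ℓ
      ; start  = w₀
      ; end    = trans (cong w (clamp-top ℓ)) wℓ
      ; inside = λ _ → inside _
      ; step   = λ a<ℓ → step _ _ (toℕ-clamp-suc ℓ a<ℓ)
      }

    toWalkIn : ∀ {ℓ u v} → Walkℕ S ℓ u v → WalkIn G S ℓ u v
    toWalkIn {ℓ} w =
      vertex ∘ toℕ , start , trans (cong vertex (toℕ-fromℕ ℓ)) end , inside ∘ toℕ≤pred[n] ,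
      λ i j j≡1+i → subst (Adj G _ ∘ vertex) (≡.sym j≡1+i)
                      (step (subst (_≤ ℓ) j≡1+i (toℕ≤pred[n] j)))
      where open Walkℕ w

    walkIn-end : ∀ {ℓ u v} → WalkIn G S ℓ u v → S v
    walkIn-end (w , _ , wℓ , inside , _) = subst S wℓ (inside _)

    walkIn-snoc : ∀ {ℓ u v x} → WalkIn G S ℓ u v → S x → Adj G v x → WalkIn G S (suc ℓ) u x
    walkIn-snoc {ℓ} {x = x} w Sx vx = toWalkIn (record
      { vertex = snoc ℓ vertex x
      ; start  = trans (snoc-≤ {ℓ = ℓ} vertex x z≤n) start
      ; end    = snoc-last ℓ vertex x
      ; inside = snoc-all S inside Sx
      ; step   = snoc-chain (Adj G) step (subst (λ y → Adj G y x) (≡.sym end) vx)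
      })
      where open Walkℕ (fromWalkIn w)

    walkIn-init : ∀ {ℓ u v} → WalkIn G S (suc ℓ) u v → ∃[ p ] WalkIn G S ℓ u p × Adj G p v
    walkIn-init {ℓ} w = vertex ℓ , toWalkIn prefix , subst (Adj G (vertex ℓ)) end (step ≤-refl)
      where
        open Walkℕ (fromWalkIn w)
        prefix : Walkℕ S ℓ _ (vertex ℓ)
        prefix = record
          { vertex = vertex
          ; start  = start
          ; end    = refl
          ; inside = λ a≤ℓ → inside (≤-trans a≤ℓ (n≤1+n ℓ))
          ; step   = λ a<ℓ → step (≤-trans a<ℓ (n≤1+n ℓ))
          }

  module Distance (S : Fin n → Set) (r : Fin n) where

    Layer : ℕ → Fin n → Set
    Layer j v = S v × WalkIn G S j r v × (∀ m → m < j → ¬ WalkIn G S m r v)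

    Layer≥ : ℕ → Fin n → Set
    Layer≥ i v = ∃[ j ] (i ≤ j × Layer j v)

    layer-unique : ∀ {i j v} → Layer i v → Layer j v → i ≡ j
    layer-unique {i} {j} (_ , wi , min-i) (_ , wj , min-j) with <-cmp i j
    ... | tri< i<j _ _ = contradiction wi (min-j i i<j)
    ... | tri≈ _ i≡j _ = i≡j
    ... | tri> _ _ j<i = contradiction wj (min-i j j<i)

    layer-not-above : ∀ {i v} → Layer i v → ¬ Layer≥ (suc i) v
    layer-not-above Li (j , 1+i≤j , Lj) with layer-unique Li Lj
    ... | refl = n≮n _ 1+i≤j

    layer-neighbour : ∀ {i j v x} → Layer i v → Layer j x → Adj G v x → j ≤ suc i
    layer-neighbour {i} (_ , wv , _) (Sx , _ , min-x) vx =
      ≮⇒≥ λ 1+i<j → min-x (suc i) 1+i<j (walkIn-snoc wv Sx vx)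

    layer-parent : ∀ {i v} → Layer (suc i) v → ∃[ p ] Layer i p × Adj G p v
    layer-parent (Sv , w , min-v) with walkIn-init {S} w
    ... | p , wp , pv =
      p , (walkIn-end wp , wp , λ m m<i wm → min-v (suc m) (s≤s m<i) (walkIn-snoc wm Sv pv)) , pv

    layer-zero : ∀ {v} → Layer 0 v → v ≡ r
    layer-zero (_ , (w , w₀ , w₁ , _) , _) = trans (≡.sym w₁) w₀

    upper-neighbour : ∀ {k p x} → Layer (suc k) p → Layer≥ (suc (suc k)) x → Adj G p x →
                      Layer (suc (suc k)) x
    upper-neighbour Lp (j , 2+k≤j , Lx) px =
      subst (λ t → Layer t _) (≤-antisym (layer-neighbour Lp Lx px) 2+k≤j) Lx

    upper-neighbours-adjacent : ClawFree G → ∀ {k p x y} →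
      Layer (suc k) p → Layer (suc (suc k)) x → Layer (suc (suc k)) y → x ≢ y →
      Adj G p x → Adj G p y → Adj G x y
    upper-neighbours-adjacent claw-free {k} {p} {x} {y} Lp Lx Ly x≢y px py
      with layer-parent Lp | adj? G x y
    ... | _           | yes xy  = xy
    ... | q , Lq , qp | no ¬xy =
      ⊥-elim (claw-free p q x y (sym G qp) px py (q≢ Lx) (q≢ Ly) x≢y (q≁ Lx) (q≁ Ly) ¬xy)
      where
        q≢ : ∀ {z} → Layer (suc (suc k)) z → q ≢ z
        q≢ Lz refl = layer-not-above Lq (suc (suc k) , n≤1+n _ , Lz)
        q≁ : ∀ {z} → Layer (suc (suc k)) z → ¬ Adj G q z
        q≁ Lz qz = n≮n _ (layer-neighbour Lq Lz qz)

  record IsInducedPathℕ (ℓ : ℕ) (f : ℕ → Fin n) : Set where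
    field
      injective : ∀ {a b} → a ≤ ℓ → b ≤ ℓ → f a ≡ f b → a ≡ b
      adjacent  : ∀ {a} → a < ℓ → Adj G (f a) (f (suc a))
      chordless : ∀ {a b} → a ≤ ℓ → b ≤ ℓ → Adj G (f a) (f b) → b ≡ suc a ⊎ a ≡ suc b

  fromIsInducedPath : ∀ {ℓ} {x : Fin (suc ℓ) → Fin n} → IsInducedPath G x →
                      IsInducedPathℕ ℓ (x ∘ clamp ℓ)
  fromIsInducedPath {ℓ} ((injective , adjacent) , chordless) = record
    { injective = λ a≤ℓ b≤ℓ → clamp-injective ℓ a≤ℓ b≤ℓ ∘ injective
    ; adjacent  = λ a<ℓ → adjacent _ _ (toℕ-clamp-suc ℓ a<ℓ)
    ; chordless = λ a≤ℓ b≤ℓ e →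
        Sum.map (toℕ-clamp-suc⁻¹ ℓ a≤ℓ b≤ℓ) (toℕ-clamp-suc⁻¹ ℓ b≤ℓ a≤ℓ) (chordless _ _ e)
    }

  cons-inducedPath : ∀ {ℓ f x} → IsInducedPathℕ ℓ f → (∀ {a} → a ≤ ℓ → x ≢ f a) →
    Adj G x (f 0) → (∀ {b} → b ≤ ℓ → Adj G x (f b) → b ≡ 0) → IsInducedPathℕ (suc ℓ) (cons x f)
  cons-inducedPath {ℓ} {f} {x} P x∉f xf₀ x-only = record
    { injective = injective′ ; adjacent = adjacent′ ; chordless = chordless′ }
    where
      open IsInducedPathℕ P
      injective′ : ∀ {a b} → a ≤ suc ℓ → b ≤ suc ℓ → cons x f a ≡ cons x f b → a ≡ b
      injective′ {zero}  {zero}  _         _         _ = refl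
      injective′ {zero}  {suc b} _         (s≤s b≤ℓ) e = contradiction e (x∉f b≤ℓ)
      injective′ {suc a} {zero}  (s≤s a≤ℓ) _         e = contradiction (≡.sym e) (x∉f a≤ℓ)
      injective′ {suc a} {suc b} (s≤s a≤ℓ) (s≤s b≤ℓ) e = cong suc (injective a≤ℓ b≤ℓ e)
      adjacent′ : ∀ {a} → a < suc ℓ → Adj G (cons x f a) (cons x f (suc a))
      adjacent′ {zero}  _         = xf₀
      adjacent′ {suc a} (s≤s a<ℓ) = adjacent a<ℓ
      chordless′ : ∀ {a b} → a ≤ suc ℓ → b ≤ suc ℓ → Adj G (cons x f a) (cons x f b) →
                   b ≡ suc a ⊎ a ≡ suc b
      chordless′ {zero}  {zero}  _         _         e = ⊥-elim (irrefl G e)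
      chordless′ {zero}  {suc b} _         (s≤s b≤ℓ) e = inj₁ (cong suc (x-only b≤ℓ e))
      chordless′ {suc a} {zero}  (s≤s a≤ℓ) _         e = inj₂ (cong suc (x-only a≤ℓ (sym G e)))
      chordless′ {suc a} {suc b} (s≤s a≤ℓ) (s≤s b≤ℓ) e =
        Sum.map (cong suc) (cong suc) (chordless a≤ℓ b≤ℓ e)

  snoc-inducedPath : ∀ {ℓ f x} → IsInducedPathℕ ℓ f → (∀ {a} → a ≤ ℓ → x ≢ f a) →
    Adj G (f ℓ) x → (∀ {b} → b ≤ ℓ → Adj G x (f b) → b ≡ ℓ) → IsInducedPathℕ (suc ℓ) (snoc ℓ f x)
  snoc-inducedPath {ℓ} {f} {x} P x∉f fℓx x-only = record
    { injective = injective′ ; adjacent = snoc-chain (Adj G) adjacent fℓx ; chordless = chordless′ }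
    where
      open IsInducedPathℕ P
      injective′ : ∀ {a b} → a ≤ suc ℓ → b ≤ suc ℓ → snoc ℓ f x a ≡ snoc ℓ f x b → a ≡ b
      injective′ a≤ b≤ with ≤-suc-view a≤ | ≤-suc-view b≤
      ... | ≤-this a≤ℓ | ≤-this b≤ℓ rewrite snoc-≤ f x a≤ℓ | snoc-≤ f x b≤ℓ = injective a≤ℓ b≤ℓ
      ... | ≤-this a≤ℓ | ≡-suc rewrite snoc-≤ f x a≤ℓ | snoc-last ℓ f x =
        λ e → contradiction (≡.sym e) (x∉f a≤ℓ)
      ... | ≡-suc | ≤-this b≤ℓ rewrite snoc-≤ f x b≤ℓ | snoc-last ℓ f x =
        λ e → contradiction e (x∉f b≤ℓ)
      ... | ≡-suc | ≡-suc = λ _ → refl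
      chordless′ : ∀ {a b} → a ≤ suc ℓ → b ≤ suc ℓ → Adj G (snoc ℓ f x a) (snoc ℓ f x b) →
                   b ≡ suc a ⊎ a ≡ suc b
      chordless′ a≤ b≤ with ≤-suc-view a≤ | ≤-suc-view b≤
      ... | ≤-this a≤ℓ | ≤-this b≤ℓ rewrite snoc-≤ f x a≤ℓ | snoc-≤ f x b≤ℓ = chordless a≤ℓ b≤ℓ
      ... | ≤-this a≤ℓ | ≡-suc rewrite snoc-≤ f x a≤ℓ | snoc-last ℓ f x =
        λ e → inj₁ (cong suc (≡.sym (x-only a≤ℓ (sym G e))))
      ... | ≡-suc | ≤-this b≤ℓ rewrite snoc-≤ f x b≤ℓ | snoc-last ℓ f x =
        λ e → inj₂ (cong suc (≡.sym (x-only b≤ℓ e)))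
      ... | ≡-suc | ≡-suc rewrite snoc-last ℓ f x = ⊥-elim ∘ irrefl G

  cons-hole : ∀ {m h x} → IsInducedPathℕ m h → 2 ≤ m → (∀ {a} → a ≤ m → x ≢ h a) →
    Adj G x (h 0) → Adj G x (h m) → (∀ {b} → b ≤ m → Adj G x (h b) → b ≡ 0 ⊎ b ≡ m) →
    IsHole G (cons x h ∘ toℕ {suc (suc m)})
  cons-hole {m} {h} {x} P 2≤m x∉h xh₀ xhₘ x-only =
    s≤s (s≤s 2≤m) , injective′ , adj⇒cyc , cyc⇒adj
    where
      open IsInducedPathℕ P
      c : Fin (suc (suc m)) → Fin n
      c = cons x h ∘ toℕ

      injective′ : ∀ {i j} → c i ≡ c j → i ≡ j
      injective′ {Fin.zero}  {Fin.zero}  _ = refl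
      injective′ {Fin.zero}  {Fin.suc j} e = contradiction e (x∉h (toℕ≤pred[n] j))
      injective′ {Fin.suc i} {Fin.zero}  e = contradiction (≡.sym e) (x∉h (toℕ≤pred[n] i))
      injective′ {Fin.suc i} {Fin.suc j} e =
        cong Fin.suc (toℕ-injective (injective (toℕ≤pred[n] i) (toℕ≤pred[n] j) e))

      adj⇒cyc : ∀ i j → Adj G (c i) (c j) → CycConsec G i j
      adj⇒cyc Fin.zero    Fin.zero    e = ⊥-elim (irrefl G e)
      adj⇒cyc Fin.zero    (Fin.suc j) e with x-only (toℕ≤pred[n] j) e
      ... | inj₁ j≡0 = inj₁ (inj₁ (cong suc j≡0))
      ... | inj₂ j≡m = inj₂ (inj₁ (refl , cong (suc ∘ suc) j≡m))
      adj⇒cyc (Fin.suc i) Fin.zero    e =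
        Sum.map Sum.swap Sum.swap (adj⇒cyc Fin.zero (Fin.suc i) (sym G e))
      adj⇒cyc (Fin.suc i) (Fin.suc j) e =
        inj₁ (Sum.map (cong suc) (cong suc) (chordless (toℕ≤pred[n] i) (toℕ≤pred[n] j) e))

      next⇒adj : ∀ i j → Next G i j → Adj G (c i) (c j)
      next⇒adj Fin.zero    (Fin.suc j) 1+j≡1 =
        subst (Adj G x ∘ h) (≡.sym (suc-injective 1+j≡1)) xh₀
      next⇒adj (Fin.suc i) (Fin.suc j) 1+j≡2+i =
        subst (Adj G (h (toℕ i)) ∘ h) (≡.sym j≡1+i) (adjacent (subst (_≤ m) j≡1+i (toℕ≤pred[n] j)))
        where j≡1+i = suc-injective 1+j≡2+i

      closing : ∀ i j → toℕ i ≡ 0 → suc (toℕ j) ≡ suc (suc m) → Adj G (c i) (c j)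
      closing Fin.zero (Fin.suc j) _ 2+j≡2+m =
        subst (Adj G x ∘ h) (≡.sym (suc-injective (suc-injective 2+j≡2+m))) xhₘ

      cyc⇒adj : ∀ i j → CycConsec G i j → Adj G (c i) (c j)
      cyc⇒adj i j (inj₁ (inj₁ i→j))            = next⇒adj i j i→j
      cyc⇒adj i j (inj₁ (inj₂ j→i))            = sym G (next⇒adj j i j→i)
      cyc⇒adj i j (inj₂ (inj₁ (i≡0 , 1+j≡K))) = closing i j i≡0 1+j≡K
      cyc⇒adj i j (inj₂ (inj₂ (j≡0 , 1+i≡K))) = sym G (closing j i j≡0 1+i≡K)

module ForbiddenPaths {n : ℕ} (G : Graph n) (S : Fin n → Set) (r : Fin n) where
  open Distance G S r

  record ForbiddenPathℕ (i ℓ : ℕ) (f : ℕ → Fin n) : Set where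
    field
      odd         : IsOdd G ℓ
      induced     : IsInducedPathℕ G ℓ f
      first       : Layer i (f 0)
      last        : Layer i (f ℓ)
      second      : Layer (suc i) (f 1)
      penultimate : ∀ {m} → suc m ≡ ℓ → Layer (suc i) (f m)
      above       : ∀ {a} → a ≤ ℓ → Layer≥ i (f a)
    open IsInducedPathℕ induced public

  no-forbidden-path-in-singleton-layer : ∀ {i ℓ f} → (∀ {v w} → Layer i v → Layer i w → v ≡ w) →
                                         ¬ ForbiddenPathℕ i ℓ f
  no-forbidden-path-in-singleton-layer singleton F =
    <⇒≢ (odd⇒positive G odd) (injective z≤n ≤-refl (singleton first last))
    where open ForbiddenPathℕ F

  module _ (claw-free : ClawFree G) (even-hole-free : EvenHoleFree G) where

    module Descent {k ℓ f} (F : ForbiddenPathℕ (suc (suc k)) ℓ f)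
                   {p₀ pℓ} (Lp₀ : Layer (suc k) p₀) (p₀f₀ : Adj G p₀ (f 0))
                   (Lpℓ : Layer (suc k) pℓ) (pℓfℓ : Adj G pℓ (f ℓ)) where
      open ForbiddenPathℕ F

      sole-neighbour : ∀ {e p b} → e ≤ ℓ →
        (∀ {c} → c ≤ ℓ → c ≡ suc e ⊎ e ≡ suc c → Layer (suc (suc (suc k))) (f c)) →
        Layer (suc k) p → Adj G p (f e) → b ≤ ℓ → Adj G p (f b) → b ≡ e
      sole-neighbour {e} {p} {b} e≤ℓ beyond Lp pe b≤ℓ pb with b ≟ e
      ... | yes b≡e = b≡e
      ... | no b≢e = contradiction (layer-unique Lfb (beyond b≤ℓ (chordless e≤ℓ b≤ℓ fe~fb))) (1+n≢n ∘ ≡.sym)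
        where
          Lfe = upper-neighbour Lp (above e≤ℓ) pe
          Lfb = upper-neighbour Lp (above b≤ℓ) pb
          fe~fb = upper-neighbours-adjacent claw-free Lp Lfe Lfb (b≢e ∘ ≡.sym ∘ injective e≤ℓ b≤ℓ) pe pb

      p₀-sole : ∀ {b} → b ≤ ℓ → Adj G p₀ (f b) → b ≡ 0
      p₀-sole = sole-neighbour z≤n after-first Lp₀ p₀f₀
        where
          after-first : ∀ {c} → c ≤ ℓ → c ≡ 1 ⊎ 0 ≡ suc c → Layer (suc (suc (suc k))) (f c)
          after-first _ (inj₁ refl) = second

      pℓ-sole : ∀ {b} → b ≤ ℓ → Adj G pℓ (f b) → b ≡ ℓ
      pℓ-sole = sole-neighbour ≤-refl before-last Lpℓ pℓfℓ
        where
          before-last : ∀ {c} → c ≤ ℓ → c ≡ suc ℓ ⊎ ℓ ≡ suc c → Layer (suc (suc (suc k))) (f c)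
          before-last 1+ℓ≤ℓ (inj₁ refl) = ⊥-elim (n≮n ℓ 1+ℓ≤ℓ)
          before-last _     (inj₂ ℓ≡1+c) = penultimate (≡.sym ℓ≡1+c)

      below-path : ∀ {p a} → Layer (suc k) p → a ≤ ℓ → p ≢ f a
      below-path Lp a≤ℓ refl = layer-not-above Lp (above a≤ℓ)

      p₀≢pℓ : p₀ ≢ pℓ
      p₀≢pℓ refl = <⇒≢ (odd⇒positive G odd) (pℓ-sole z≤n p₀f₀)

      h : ℕ → Fin n
      h = snoc ℓ f pℓ

      h₀ : h 0 ≡ f 0
      h₀ = snoc-≤ {ℓ = ℓ} f pℓ z≤n

      h-last : h (suc ℓ) ≡ pℓ
      h-last = snoc-last ℓ f pℓ

      h-induced : IsInducedPathℕ G (suc ℓ) h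
      h-induced = snoc-inducedPath G induced (below-path Lpℓ) (sym G pℓfℓ) pℓ-sole

      p₀∉h : ∀ {a} → a ≤ suc ℓ → p₀ ≢ h a
      p₀∉h = snoc-all (p₀ ≢_) (below-path Lp₀) p₀≢pℓ

      p₀h₀ : Adj G p₀ (h 0)
      p₀h₀ = subst (Adj G p₀) (≡.sym h₀) p₀f₀

      p₀-neighbours : ∀ {b} → b ≤ suc ℓ → Adj G p₀ (h b) → b ≡ 0 ⊎ b ≡ suc ℓ
      p₀-neighbours b≤ with ≤-suc-view b≤
      ... | ≤-this b≤ℓ rewrite snoc-≤ f pℓ b≤ℓ = inj₁ ∘ p₀-sole b≤ℓ
      ... | ≡-suc = λ _ → inj₂ refl

      no-closing-edge : ¬ Adj G p₀ pℓ
      no-closing-edge p₀pℓ =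
        even-hole-free _ _
          (cons-hole G h-induced (s≤s (odd⇒positive G odd)) p₀∉h p₀h₀
                     (subst (Adj G p₀) (≡.sym h-last) p₀pℓ) p₀-neighbours)
          (odd⇒suc-even G (odd-suc-suc G odd))

      descended : ForbiddenPathℕ (suc k) (suc (suc ℓ)) (cons p₀ h)
      descended = record
        { odd         = odd-suc-suc G odd
        ; induced     = cons-inducedPath G h-induced p₀∉h p₀h₀ p₀-only
        ; first       = Lp₀
        ; last        = subst (Layer (suc k)) (≡.sym h-last) Lpℓ
        ; second      = subst (Layer (suc (suc k))) (≡.sym h₀) first
        ; penultimate = λ { refl → subst (Layer (suc (suc k))) (≡.sym (snoc-≤ f pℓ ≤-refl)) last }
        ; above       = above′
        }
        where
          p₀-only : ∀ {b} → b ≤ suc ℓ → Adj G p₀ (h b) → b ≡ 0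
          p₀-only b≤ p₀hb with p₀-neighbours b≤ p₀hb
          ... | inj₁ b≡0 = b≡0
          ... | inj₂ refl = contradiction (subst (Adj G p₀) h-last p₀hb) no-closing-edge
          weaken : ∀ {v} → Layer≥ (suc (suc k)) v → Layer≥ (suc k) v
          weaken (j , 2+k≤j , Lj) = j , ≤-trans (n≤1+n _) 2+k≤j , Lj
          above′ : ∀ {a} → a ≤ suc (suc ℓ) → Layer≥ (suc k) (cons p₀ h a)
          above′ {zero}  _        = suc k , ≤-refl , Lp₀
          above′ {suc a} (s≤s a≤) = snoc-all (Layer≥ (suc k)) (weaken ∘ above) (suc k , ≤-refl , Lpℓ) a≤

    descend : ∀ {k ℓ f} → ForbiddenPathℕ (suc (suc k)) ℓ f →
              ∃[ g ] ForbiddenPathℕ (suc k) (suc (suc ℓ)) g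
    descend F with layer-parent (ForbiddenPathℕ.first F) | layer-parent (ForbiddenPathℕ.last F)
    ... | _ , Lp₀ , p₀f₀ | _ , Lpℓ , pℓfℓ = _ , Descent.descended F Lp₀ p₀f₀ Lpℓ pℓfℓ

    no-forbidden-path : (∀ {v w} → Layer 1 v → Layer 1 w → v ≡ w) →
                        ∀ i {ℓ f} → ¬ ForbiddenPathℕ i ℓ f
    no-forbidden-path _ zero =
      no-forbidden-path-in-singleton-layer λ Lv Lw → trans (layer-zero Lv) (≡.sym (layer-zero Lw))
    no-forbidden-path singleton₁ (suc zero) = no-forbidden-path-in-singleton-layer singleton₁
    no-forbidden-path singleton₁ (suc (suc k)) F =
      no-forbidden-path singleton₁ (suc k) (proj₂ (descend F))

module _ {n : ℕ} (G : Graph n) (u0 u1 : Fin n) where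
  open Layers G u0 u1
  open Distance G InG0 u0
  open ForbiddenPaths G InG0 u0

  L₁⇒≡u1 : ∀ {v} → L 1 v → v ≡ u1
  L₁⇒≡u1 {v} L₁v with v Fin.≟ u1 | layer-parent L₁v
  ... | yes v≡u1 | _ = v≡u1
  ... | no v≢u1  | p , L₀p , pv =
    ⊥-elim (walkIn-end G {λ w → ¬ B0 w} (proj₂ (proj₁ L₁v))
                       (subst (λ q → Adj G q v) (layer-zero L₀p) pv , v≢u1))

  induced-forbiddenPathℕ : ∀ {ℓ x} → ForbiddenPath ℓ x → IsInducedPath G x →
                           ∃[ i ] ForbiddenPathℕ i ℓ (x ∘ clamp ℓ)
  induced-forbiddenPathℕ {ℓ} {x} (odd , _ , _ , (i , first , last , second , penultimate , above) , _)
                         induced = i , record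
    { odd         = odd
    ; induced     = fromIsInducedPath G induced
    ; first       = first
    ; last        = subst (L i ∘ x) (≡.sym (clamp-top ℓ)) last
    ; second      = second _ (toℕ-clamp ℓ (odd⇒positive G odd))
    ; penultimate = λ {m} 1+m≡ℓ →
        penultimate _ (trans (cong suc (toℕ-clamp ℓ (subst (m ≤_) 1+m≡ℓ (n≤1+n m)))) 1+m≡ℓ)
    ; above       = λ _ → above _
    }

lemma2p3 : ∀ (n : ℕ) (G : Graph n) → ClawFree G → EvenHoleFree G →
    ∀ (u0 u1 : Fin n) → Adj G u0 u1 →
    ¬ (∃[ ℓ ] ∃[ x ] Layers.ForbiddenPath G u0 u1 ℓ x)
lemma2p3 n G claw-free even-hole-free u0 u1 _ (ℓ , x , F@(odd , _ , _ , _ , shape)) with shape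
... | inj₂ hole    = even-hole-free (suc ℓ) x hole (odd⇒suc-even G odd)
... | inj₁ induced =
  let i , F′ = induced-forbiddenPathℕ G u0 u1 F induced
  in ForbiddenPaths.no-forbidden-path G (Layers.InG0 G u0 u1) u0 claw-free even-hole-free
       (λ Lv Lw → trans (L₁⇒≡u1 G u0 u1 Lv) (≡.sym (L₁⇒≡u1 G u0 u1 Lw))) i F′
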